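{- Let $n\geqslant 7$ and $2<m<n$. If the set $\{r_n,r_m,r_2\}$ generates $\mathrm{Sym}_n$, then $m\geqslant n-4$. Furthermore, if in addition $n$ is odd, then $m\geqslant n-3$.
   Context: $\mathrm{Sym}_n$ is the symmetric group on $\{1,\dots,n\}$. For $1< i\leqslant n$, the prefix reversal $r_i\in\mathrm{Sym}_n$ is the permutation with $r_i(j)=i+1-j$ for $1\leqslant j\leqslant i$ and $r_i(j)=j$ for $i<j\leqslant n$. -}

module Defs where

open import Data.Nat using (ℕ; zero; suc; _∸_; _≤_; _<_; s≤s; z≤n; _<?_)
open import Data.Nat.Properties
open import Data.Fin using (Fin; toℕ; fromℕ<)
open import Data.Fin.Properties using (toℕ-fromℕ<; toℕ-injective)
open import Data.Fin.Permutation using (Permutation′; permutation; id; flip; _∘ₚ_; _⟨$⟩ʳ_)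
open import Data.List using (List)
open import Data.List.Membership.Propositional using (_∈_)
open import Data.Product using (Σ; _×_; _,_)
open import Relation.Nullary using (yes; no)
open import Data.Empty using (⊥-elim)
open import Relation.Binary.PropositionalEquality

-- Points 1..n of the paper are represented by Fin n = {0,…,n-1} (point j ↦ j-1).
-- Prefix reversal r_i (i ≤ n): position j (0-based) with j < i goes to i-1-j,
-- the other positions are fixed.  This is the paper's r_i(j) = i+1-j shifted by one.

private
  lemma-bound : ∀ {n i k} → i ≤ n → k < i → i ∸ suc k < n
  lemma-bound {n} {i} {k} i≤n k<i =
    ≤-trans (≤-reflexive (sym (+-∸-assoc 1 k<i))) (≤-trans (m∸n≤m i k) i≤n)

revFun : (n i : ℕ) → i ≤ n → Fin n → Fin n
revFun n i i≤n j with toℕ j <? i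
... | yes p = fromℕ< (lemma-bound i≤n p)
... | no _  = j

private
  lt-i : ∀ {i k} → k < i → i ∸ suc k < i
  lt-i {i} {k} k<i = ≤-trans (≤-reflexive (sym (+-∸-assoc 1 k<i))) (m∸n≤m i k)

  rev-inv : ∀ n i (i≤n : i ≤ n) j → revFun n i i≤n (revFun n i i≤n j) ≡ j
  rev-inv n i i≤n j with toℕ j <? i
  ... | no q with toℕ j <? i
  ...   | yes p = ⊥-elim (q p)
  ...   | no _  = refl
  rev-inv n i i≤n j | yes p
    with toℕ (fromℕ< (lemma-bound {n} {i} {toℕ j} i≤n p)) <? i
       | toℕ-fromℕ< (lemma-bound {n} {i} {toℕ j} i≤n p)
  ... | yes p′ | e = toℕ-injective (trans (toℕ-fromℕ< _) (trans (cong (λ x → i ∸ suc x) e) key))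
    where
      key : i ∸ suc (i ∸ suc (toℕ j)) ≡ toℕ j
      key = trans (cong (i ∸_) (sym (+-∸-assoc 1 p))) (m∸[m∸n]≡n (<⇒≤ p))
  ... | no q′ | e = ⊥-elim (q′ (subst (_< i) (sym e) (lt-i p)))

rev : (n i : ℕ) → i ≤ n → Permutation′ n
rev n i i≤n = permutation (revFun n i i≤n) (revFun n i i≤n) (rev-inv n i i≤n) (rev-inv n i i≤n)

data ⟨_⟩ {n : ℕ} (gs : List (Permutation′ n)) : Permutation′ n → Set where
  gen  : ∀ {g} → g ∈ gs → ⟨ gs ⟩ g
  one  : ⟨ gs ⟩ id
  mul  : ∀ {g h} → ⟨ gs ⟩ g → ⟨ gs ⟩ h → ⟨ gs ⟩ (g ∘ₚ h)
  inv  : ∀ {g} → ⟨ gs ⟩ g → ⟨ gs ⟩ (flip g)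

Generates : {n : ℕ} → List (Permutation′ n) → Set
Generates {n} gs = (π : Permutation′ n) →
  Σ (Permutation′ n) λ σ → ⟨ gs ⟩ σ × (∀ j → σ ⟨$⟩ʳ j ≡ π ⟨$⟩ʳ j)

{-# OPTIONS --safe #-}
-- Let k = n - m and call a position x (counted from 0) marked when x or its mirror
-- image n - 1 - x is congruent to 0 or 1 modulo k.  The reversal r_n exchanges x and
-- its mirror image; since n = m + k, the reversal r_m sends x to m - 1 - x, which is
-- congruent to the mirror image n - 1 - x, and its mirror image is congruent to x;
-- r_2 only moves the marked positions 0 and 1.  Hence every element of the generated
-- group maps marked positions to marked positions.  When k ≥ 5, or k = 4 and n is
-- odd, one of the positions 2, 3, 4 is unmarked, so the transposition exchanging it
-- with the marked position 0 is not generated.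
module Submission where

open import Defs
open import Data.Nat using (ℕ; zero; suc; _≤_; _<_; _+_; _∸_; _%_; NonZero; z≤n; s≤s; z<s; _≤?_; _<?_)
open import Data.Nat.Properties
  using ( ≤-refl; ≤-reflexive; ≤-trans; <⇒≤; ≰⇒>; <⇒≱; n≤1+n; +-suc; +-assoc
        ; +-∸-assoc; +-∸-comm; m∸n≤m; m∸[m∸n]≡n; m≤n⇒∃[o]m+o≡n)
open import Data.Nat.DivMod
  using (%-distribˡ-+; m%n%n≡m%n; [m+n]%n≡m%n; m%n≤m; m%n<n; m<n⇒m%n≡m; m∣n⇒o%n%m≡o%m)
open import Data.Nat.Divisibility using (divides)
open import Data.Fin using (Fin; toℕ; fromℕ<; _≟_)
open import Data.Fin.Properties using (toℕ-fromℕ<)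
open import Data.Fin.Permutation using (Permutation′; _⟨$⟩ʳ_; _⟨$⟩ˡ_; inverseʳ; transpose)
open import Data.List using (List; _∷_; [])
open import Data.List.Membership.Propositional using (_∈_)
open import Data.List.Relation.Unary.Any using (here; there)
open import Data.Product using (_×_; ∃-syntax; _,_)
open import Data.Sum using (_⊎_; inj₁; inj₂; [_,_]; swap; map; map₂)
open import Data.Empty using (⊥; ⊥-elim)
open import Function using (_∘_)
open import Function.Bundles using (_⇔_; mk⇔; Equivalence)
open import Function.Construct.Identity using (⇔-id)
open import Function.Construct.Composition using (_⇔-∘_)
open import Function.Construct.Symmetry using (⇔-sym)
open import Relation.Nullary using (¬_; yes; no)
open import Relation.Nullary.Decidable using (decidable-stable)
open import Relation.Binary.PropositionalEquality
  using (_≡_; refl; sym; trans; cong; subst; module ≡-Reasoning)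
open ≡-Reasoning

Invariant : ∀ {n} → (Fin n → Set) → Permutation′ n → Set
Invariant P σ = ∀ j → P j ⇔ P (σ ⟨$⟩ʳ j)

transpose-maps : ∀ {n} (i j : Fin n) → transpose i j ⟨$⟩ʳ i ≡ j
transpose-maps i j with i ≟ i
... | yes _  = refl
... | no i≢i = ⊥-elim (i≢i refl)

module _ {n} {P : Fin n → Set} {gs : List (Permutation′ n)}
         (generators-invariant : ∀ {g} → g ∈ gs → Invariant P g) where

  ⟨⟩-invariant : ∀ {σ} → ⟨ gs ⟩ σ → Invariant P σ
  ⟨⟩-invariant (gen g∈gs) = generators-invariant g∈gs
  ⟨⟩-invariant one j = ⇔-id _
  ⟨⟩-invariant (mul {g} g∈ h∈) j = ⟨⟩-invariant h∈ (g ⟨$⟩ʳ j) ⇔-∘ ⟨⟩-invariant g∈ j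
  ⟨⟩-invariant (inv {g} g∈) j =
    ⇔-sym (subst (λ i → P (g ⟨$⟩ˡ j) ⇔ P i) (inverseʳ g) (⟨⟩-invariant g∈ (g ⟨$⟩ˡ j)))

  invariant⇒¬Generates : ∀ {i j} → P i → ¬ P j → ¬ Generates gs
  invariant⇒¬Generates {i} {j} Pi ¬Pj G with G (transpose i j)
  ... | σ , σ∈ , σ≗ =
    ¬Pj (subst P (trans (σ≗ i) (transpose-maps i j)) (Equivalence.to (⟨⟩-invariant σ∈ i) Pi))

reflect-< : ∀ {i x} → x < i → i ∸ suc x < i
reflect-< {i} {x} x<i = ≤-trans (≤-reflexive (sym (+-∸-assoc 1 x<i))) (m∸n≤m i x)

reflect-involutive : ∀ {i x} → x < i → i ∸ suc (i ∸ suc x) ≡ x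
reflect-involutive {i} x<i = trans (cong (i ∸_) (sym (+-∸-assoc 1 x<i))) (m∸[m∸n]≡n (<⇒≤ x<i))

rev-invariant : ∀ {n i} (i≤n : i ≤ n) (P : ℕ → Set) →
                (∀ {x} → x < i → P x → P (i ∸ suc x)) → Invariant (P ∘ toℕ) (rev n i i≤n)
rev-invariant {i = i} i≤n P reflect-P j with toℕ j <? i
... | no _    = ⇔-id _
... | yes x<i = subst (λ y → P (toℕ j) ⇔ P y) (sym (toℕ-fromℕ< _))
                  (mk⇔ (reflect-P x<i) (subst P (reflect-involutive x<i) ∘ reflect-P (reflect-< x<i)))

-- Positions are counted from 0, so the mirror image of x is n ∸ suc x.
Marked : (n k : ℕ) .{{_ : NonZero k}} → ℕ → Set
Marked n k x = x % k ≤ 1 ⊎ (n ∸ suc x) % k ≤ 1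

module _ {k : ℕ} .{{_ : NonZero k}} where

  Marked-≤1 : ∀ {n x} → x ≤ 1 → Marked n k x
  Marked-≤1 {x = x} x≤1 = inj₁ (≤-trans (m%n≤m x k) x≤1)

  Marked-reflect : ∀ {n x} → x < n → Marked n k x → Marked n k (n ∸ suc x)
  Marked-reflect x<n = map₂ (subst (_≤ 1) (sym (cong (_% k) (reflect-involutive x<n)))) ∘ swap

  reflect-%-prefix : ∀ {n m y} → n ≡ m + k → y < m → (n ∸ suc y) % k ≡ (m ∸ suc y) % k
  reflect-%-prefix {m = m} {y} refl y<m =
    trans (cong (_% k) (+-∸-comm k y<m)) ([m+n]%n≡m%n (m ∸ suc y) k)

  Marked-reflect-prefix : ∀ {n m x} → n ≡ m + k → x < m → Marked n k x → Marked n k (m ∸ suc x)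
  Marked-reflect-prefix {n} {m} {x} n≡m+k x<m = map (subst (_≤ 1) (reflect-%-prefix n≡m+k x<m))
                                        (subst (_≤ 1) (sym mirror≡)) ∘ swap
    where
    mirror≡ : (n ∸ suc (m ∸ suc x)) % k ≡ x % k
    mirror≡ = trans (reflect-%-prefix n≡m+k (reflect-< x<m)) (cong (_% k) (reflect-involutive x<m))

reversalGenerators : ∀ {n m} → 2 < m → m < n → List (Permutation′ n)
reversalGenerators {n} {m} 2<m m<n =
  rev n n ≤-refl ∷ rev n m (<⇒≤ m<n) ∷ rev n 2 (≤-trans (<⇒≤ 2<m) (<⇒≤ m<n)) ∷ []

module _ {n m k : ℕ} .{{_ : NonZero k}} (2<m : 2 < m) (m<n : m < n) (n≡m+k : n ≡ m + k) where

  reversalGenerators-invariant : ∀ {g} → g ∈ reversalGenerators 2<m m<n →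
                                 Invariant (Marked n k ∘ toℕ) g
  reversalGenerators-invariant (here refl) = rev-invariant ≤-refl (Marked n k) Marked-reflect
  reversalGenerators-invariant (there (here refl)) =
    rev-invariant (<⇒≤ m<n) (Marked n k) (Marked-reflect-prefix n≡m+k)
  reversalGenerators-invariant (there (there (here refl))) =
    rev-invariant (≤-trans (<⇒≤ 2<m) (<⇒≤ m<n)) (Marked n k) (λ {x} _ _ → Marked-≤1 {n = n} (m∸n≤m 1 x))

  unmarked⇒¬Generates : ∀ {y} → y < n → ¬ Marked n k y → ¬ Generates (reversalGenerators 2<m m<n)
  unmarked⇒¬Generates y<n ¬marked =
    invariant⇒¬Generates reversalGenerators-invariant
      (subst (Marked n k) (sym (toℕ-fromℕ< 0<n)) (Marked-≤1 {n = n} z≤n))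
      (¬marked ∘ subst (Marked n k) (toℕ-fromℕ< y<n))
    where
    0<n : 0 < n
    0<n = ≤-trans z<s m<n

[m+n]%o≡[m+n%o]%o : ∀ m n o .{{_ : NonZero o}} → (m + n) % o ≡ (m + n % o) % o
[m+n]%o≡[m+n%o]%o m n o = begin
  (m + n) % o             ≡⟨ %-distribˡ-+ m n o ⟩
  (m % o + n % o) % o     ≡⟨ cong (λ r → (m % o + r) % o) (m%n%n≡m%n n o) ⟨
  (m % o + n % o % o) % o ≡⟨ %-distribˡ-+ m (n % o) o ⟨
  (m + n % o) % o         ∎

-- In 0, …, 4 + a the mirror images of 2, 3, 4 are 2 + a, 1 + a, a.
module _ {a k : ℕ} .{{_ : NonZero k}} where

  private
    1<%k : ∀ {c} → 1 < c → c < k → 1 < c % k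
    1<%k 1<c c<k = subst (1 <_) (sym (m<n⇒m%n≡m c<k)) 1<c

    unmarked : ∀ {y} → 1 < y % k → 1 < (5 + a ∸ suc y) % k → ¬ Marked (5 + a) k y
    unmarked 1<y%k 1<mirror%k = [ <⇒≱ 1<y%k , <⇒≱ 1<mirror%k ]

  ¬Marked-2 : 3 < k → a % k ≤ 1 → ¬ Marked (5 + a) k 2
  ¬Marked-2 3<k a%k≤1 =
    unmarked (1<%k (s≤s (s≤s z≤n)) (≤-trans (n≤1+n 3) 3<k))
             (subst (1 <_) (sym ([m+n]%o≡[m+n%o]%o 2 a k))
                    (1<%k (s≤s (s≤s z≤n)) (≤-trans (s≤s (s≤s (s≤s a%k≤1))) 3<k)))

  ¬Marked-3 : 3 < k → a % k ≡ 2 → ¬ Marked (5 + a) k 3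
  ¬Marked-3 3<k a%k≡2 =
    unmarked (1<%k (s≤s (s≤s z≤n)) 3<k)
             (subst (1 <_) (sym (trans ([m+n]%o≡[m+n%o]%o 1 a k) (cong (λ r → (1 + r) % k) a%k≡2)))
                    (1<%k (s≤s (s≤s z≤n)) 3<k))

  ¬Marked-4 : 4 < k → 1 < a % k → ¬ Marked (5 + a) k 4
  ¬Marked-4 4<k 1<a%k = unmarked (1<%k (s≤s (s≤s z≤n)) 4<k) 1<a%k

unmarked-witness-wide : ∀ {n k} .{{_ : NonZero k}} → 5 ≤ n → 4 < k → ∃[ y ] y < n × ¬ Marked n k y
unmarked-witness-wide {k = k} (s≤s (s≤s (s≤s (s≤s (s≤s {n = a} _))))) 4<k with a % k ≤? 1
... | yes a%k≤1 = 2 , s≤s (s≤s (s≤s z≤n)) , ¬Marked-2 (<⇒≤ 4<k) a%k≤1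
... | no a%k≰1  = 4 , s≤s (s≤s (s≤s (s≤s (s≤s z≤n)))) , ¬Marked-4 4<k (≰⇒> a%k≰1)

unmarked-witness-odd : ∀ {n} → 5 ≤ n → n % 2 ≡ 1 → ∃[ y ] y < n × ¬ Marked n 4 y
unmarked-witness-odd (s≤s (s≤s (s≤s (s≤s (s≤s {n = a} _))))) odd = by-residue (a % 4) refl (m%n<n a 4)
  where
  [5+a]%2≡0 : a % 4 ≡ 3 → (5 + a) % 2 ≡ 0
  [5+a]%2≡0 a%4≡3 = begin
    (5 + a) % 2         ≡⟨ m∣n⇒o%n%m≡o%m 2 4 (5 + a) (divides 2 refl) ⟨
    (5 + a) % 4 % 2     ≡⟨ cong (_% 2) ([m+n]%o≡[m+n%o]%o 5 a 4) ⟩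
    (5 + a % 4) % 4 % 2 ≡⟨ cong (λ r → (5 + r) % 4 % 2) a%4≡3 ⟩
    0                   ∎

  by-residue : ∀ s → a % 4 ≡ s → s < 4 → ∃[ y ] y < 5 + a × ¬ Marked (5 + a) 4 y
  by-residue 0 a%4≡0 _ = 2 , s≤s (s≤s (s≤s z≤n)) , ¬Marked-2 {a = a} ≤-refl (subst (_≤ 1) (sym a%4≡0) z≤n)
  by-residue 1 a%4≡1 _ = 2 , s≤s (s≤s (s≤s z≤n)) , ¬Marked-2 {a = a} ≤-refl (subst (_≤ 1) (sym a%4≡1) ≤-refl)
  by-residue 2 a%4≡2 _ = 3 , s≤s (s≤s (s≤s (s≤s z≤n))) , ¬Marked-3 {a = a} ≤-refl a%4≡2
  by-residue 3 a%4≡3 _ with () ← trans (sym ([5+a]%2≡0 a%4≡3)) odd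
  by-residue (suc (suc (suc (suc _)))) _ (s≤s (s≤s (s≤s (s≤s ()))))

unmarked-witness : ∀ {n} d → 5 ≤ n → 0 < d ⊎ n % 2 ≡ 1 → ∃[ y ] y < n × ¬ Marked n (4 + d) y
unmarked-witness (suc d) 5≤n _          = unmarked-witness-wide 5≤n (s≤s (s≤s (s≤s (s≤s (s≤s z≤n)))))
unmarked-witness zero    5≤n (inj₂ odd) = unmarked-witness-odd 5≤n odd

m+c<n⇒∃[d]n≡m+[1+c+d] : ∀ {m n} c → m + c < n → ∃[ d ] n ≡ m + (suc c + d)
m+c<n⇒∃[d]n≡m+[1+c+d] {m} {n} c m+c<n with m≤n⇒∃[o]m+o≡n m+c<n
... | d , 1+m+c+d≡n = d , (begin
  n               ≡⟨ 1+m+c+d≡n ⟨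
  suc (m + c) + d ≡⟨ cong (_+ d) (+-suc m c) ⟨
  m + suc c + d   ≡⟨ +-assoc m (suc c) d ⟩
  m + (suc c + d) ∎)

lemma5 : (n m : ℕ) → 7 ≤ n → (2<m : 2 < m) → (m<n : m < n) →
    Generates (rev n n ≤-refl ∷ rev n m (<⇒≤ m<n) ∷ rev n 2 (≤-trans (<⇒≤ 2<m) (<⇒≤ m<n)) ∷ []) →
    (n ≤ m + 4) × (n % 2 ≡ 1 → n ≤ m + 3)
lemma5 n m 7≤n 2<m m<n G = n≤m+4 , n≤m+3
  where
  impossible : ∀ d → n ≡ m + (4 + d) → 0 < d ⊎ n % 2 ≡ 1 → ⊥
  impossible d n≡m+k h with unmarked-witness d (≤-trans (s≤s (s≤s (s≤s (s≤s (s≤s z≤n))))) 7≤n) h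
  ... | y , y<n , ¬marked = unmarked⇒¬Generates 2<m m<n n≡m+k y<n ¬marked G

  n≤m+4 : n ≤ m + 4
  n≤m+4 = decidable-stable (n ≤? m + 4) λ n≰m+4 →
    let d , n≡m+5+d = m+c<n⇒∃[d]n≡m+[1+c+d] 4 (≰⇒> n≰m+4) in impossible (suc d) n≡m+5+d (inj₁ z<s)

  n≤m+3 : n % 2 ≡ 1 → n ≤ m + 3
  n≤m+3 odd = decidable-stable (n ≤? m + 3) λ n≰m+3 →
    let d , n≡m+4+d = m+c<n⇒∃[d]n≡m+[1+c+d] 3 (≰⇒> n≰m+3) in impossible d n≡m+4+d (inj₂ odd)
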